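{- Let $r\ge 2$ be an integer, let $\varphi$ be an instance of \textsc{2-Clause 3-SAT}, and let $G(\varphi)$ be the graph constructed from $\varphi$ as described in the context. If $\varphi$ is satisfiable, then $\mathrm{col}_r(G(\varphi))\le 6$.
   Context: \textsc{2-Clause 3-SAT}: a CNF formula $\varphi$ with clauses $c_1,\dots,c_m$ over variables $x_1,\dots,x_n$, each clause containing at most 3 variables, each literal ($x_j$ or $\overline{x}_j$) appearing in exactly 2 clauses; it is assumed no variable appears twice in a clause and every clause has 2 or 3 literals. An $\ell$-subdivided edge between $a$ and $b$ is an induced path with $\ell$ new internal vertices (with no other neighbours) joining $a$ and $b$. Construction of $G(\varphi)$: a clause vertex $u_i$ for each clause $c_i$; for each variable $x_j$ two adjacent literal vertices $v_j$ (for $x_j$) and $v_j'$ (for $\overline{x}_j$); for each clause $c_i$ containing $x_j$ (resp. $\overline{x}_j$) join $u_i$ and $v_j$ (resp. $v_j'$) by an $(r-1)$-subdivided edge. Add a 7-clique on new vertices $w_1,\dots,w_7$; make every $u_i$ adjacent to $w_1,\dots,w_4$, and additionally to $w_5$ if $c_i$ has only 2 literals; make every $v_j$ adjacent to $w_2,w_3,w_4$ and every $v_j'$ adjacent to $w_5,w_6,w_7$. Coloring number: for a total order $\sigma$ on $V(G)$ and $u\neq v$, $v$ is $r$-reachable from $u$ if $v\not<_\sigma u$ and there is a $u$-$v$ path $P$ of length at most $r$ whose internal vertices $p$ all satisfy $p<_\sigma u$; $\mathrm{reach}_r(u,G_\sigma)$ is the set of such $v$, and $\mathrm{col}_r(G)=\min_\sigma\max_u|\mathrm{reach}_r(u,G_\sigma)|$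 over total orders $\sigma$. -}

module Defs where

open import Data.Nat using (ℕ; zero; suc; _≤_; _<_; _∸_)
open import Data.Fin using (Fin; toℕ; #_)
open import Data.Bool using (Bool; true; false)
open import Data.List using (List; []; _∷_; _++_; length; map; lookup)
open import Data.List.Membership.Propositional using (_∈_)
open import Data.List.Relation.Unary.All using (All)
open import Data.List.Relation.Unary.Unique.Propositional using (Unique)
open import Data.List.Relation.Unary.Linked using (Linked)
open import Data.Product using (Σ; ∃; _×_; _,_; proj₁; proj₂)
open import Data.Sum using (_⊎_)
open import Relation.Binary.PropositionalEquality using (_≡_)
open import Relation.Nullary using (¬_)
open import Function.Definitions using (Injective)

-- Formulas.  A literal over variables Fin n is a pair (j , b):
-- (j , true) is x_j and (j , false) is ¬x_j.

Literal : ℕ → Set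
Literal n = Fin n × Bool

record Instance : Set where
  field
    n m      : ℕ
    clause   : Fin m → List (Literal n)
    size23   : ∀ i → length (clause i) ≡ 2 ⊎ length (clause i) ≡ 3
    varsDistinct : ∀ i → Unique (map proj₁ (clause i))
    exactlyTwo : ∀ (ℓ : Literal n) →
      Σ (Fin m) λ i → Σ (Fin m) λ i' →
        ¬ (i ≡ i') × ℓ ∈ clause i × ℓ ∈ clause i' ×
        (∀ i'' → ℓ ∈ clause i'' → i'' ≡ i ⊎ i'' ≡ i')

open Instance public

Satisfiable : Instance → Set
Satisfiable φ = Σ (Fin (n φ) → Bool) λ α →
  ∀ i → Σ (Literal (n φ)) λ ℓ → ℓ ∈ clause φ i × α (proj₁ ℓ) ≡ proj₂ ℓ

record Graph : Set₁ where
  field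
    V   : Set
    Adj : V → V → Set

-- Vertices:
--   u i          clause vertex u_i
--   lit j true   literal vertex v_j ;  lit j false  literal vertex v_j'
--   w k          clique vertex w_{k+1}  (k : Fin 7)
--   sub i p t    the t-th (0-based) internal vertex of the (r-1)-subdivided
--                edge between u_i and the vertex of the p-th literal of c_i.
data GV (r : ℕ) (φ : Instance) : Set where
  u   : Fin (m φ) → GV r φ
  lit : Fin (n φ) → Bool → GV r φ
  w   : Fin 7 → GV r φ
  sub : (i : Fin (m φ)) → Fin (length (clause φ i)) → Fin (r ∸ 1) → GV r φ

litV : ∀ {r φ} → Literal (n φ) → GV r φ
litV (j , b) = lit j b

-- One orientation of each edge.
data GE (r : ℕ) (φ : Instance) : GV r φ → GV r φ → Set where
  w-w     : ∀ {k k'} → toℕ k < toℕ k' → GE r φ (w k) (w k')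
  lit-lit : ∀ {j} → GE r φ (lit j true) (lit j false)
  u-w     : ∀ {i k} → toℕ k < 4 → GE r φ (u i) (w k)
  u-w5    : ∀ {i} → length (clause φ i) ≡ 2 → GE r φ (u i) (w (# 4))
  pos-w   : ∀ {j k} → 1 ≤ toℕ k → toℕ k ≤ 3 → GE r φ (lit j true) (w k)
  neg-w   : ∀ {j k} → 4 ≤ toℕ k → GE r φ (lit j false) (w k)
  u-sub   : ∀ {i p t} → toℕ t ≡ 0 → GE r φ (u i) (sub i p t)
  sub-sub : ∀ {i p t t'} → suc (toℕ t) ≡ toℕ t' → GE r φ (sub i p t) (sub i p t')
  sub-lit : ∀ {i p t} → suc (toℕ t) ≡ r ∸ 1 →
            GE r φ (sub i p t) (litV (lookup (clause φ i) p))

G : ℕ → Instance → Graph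
G r φ = record { V = GV r φ ; Adj = λ x y → GE r φ x y ⊎ GE r φ y x }

-- Weak r-reachability and the r-colouring number.
-- A total order σ on V is given by an injective rank function V → ℕ:
-- x <σ y  iff  rank x < rank y.

module _ (Γ : Graph) where
  open Graph Γ

  Reachable : ℕ → (V → ℕ) → V → V → Set
  Reachable r rank x y =
    ¬ (y ≡ x) × ¬ (rank y < rank x) ×
    Σ (List V) λ ps →
      Linked Adj (x ∷ ps ++ y ∷ []) ×
      Unique (x ∷ ps ++ y ∷ []) ×
      suc (length ps) ≤ r ×
      All (λ p → rank p < rank x) ps

  ColLe : ℕ → ℕ → Set
  ColLe r k = Σ (V → ℕ) λ rank → Injective _≡_ _≡_ rank ×
    (∀ x (ys : List V) → Unique ys → All (Reachable r rank x) ys → length ys ≤ k)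

-- Let α satisfy φ and order V(G) by level: the subdivision vertices, then the literal vertices made
-- true by α, the clause vertices, the literal vertices made false by α, and finally the clique.
-- A path witnessing r-reachability from x has all internal vertices below x, which confines it:
-- from w_k only the later clique vertices are reachable; from a subdivision vertex only the two
-- ends and the successor on its own path; from a true literal its negation, its three clique
-- neighbours and the (at most two) clause vertices at the far ends of its subdivided edges; from a
-- false literal, whose subdivided edges cannot be crossed within r steps, only w_2, ..., w_7; and
-- from a clause vertex its four or five clique neighbours and its literals except a true one,
-- which lies below it. Each of these sets has at most six elements.

module Submission where

open import Defs
open import Data.Bool using (Bool; true; false; not; if_then_else_)
open import Data.Bool.Properties using (¬-not; not-¬) renaming (_≟_ to _≟ᵇ_)
open import Data.Empty using (⊥; ⊥-elim)
open import Data.Fin using (Fin; toℕ) renaming (zero to fzero; suc to fsuc)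
open import Data.Fin.Patterns using (0F; 1F; 2F; 3F; 4F; 5F; 6F)
open import Data.Fin.Properties using (toℕ<n; toℕ-injective; pigeonhole)
open import Data.List using (List; []; _∷_; _++_; length; map; lookup; allFin)
open import Data.List.Properties using (length-map; length-++)
open import Data.List.Membership.Propositional using (_∈_)
open import Data.List.Membership.Propositional.Properties
  using (∈-lookup; ∈-map⁺; ∈-++⁺ˡ; ∈-++⁺ʳ; ∈-allFin)
open import Data.List.Membership.Setoid.Properties using (index-injective)
open import Data.List.Relation.Unary.All as All using (All; []; _∷_)
open import Data.List.Relation.Unary.AllPairs using (_∷_)
open import Data.List.Relation.Unary.Any using (here; there; index)
open import Data.List.Relation.Unary.Linked as Linked using (Linked; [-]; _∷_)
open import Data.List.Relation.Unary.Unique.Propositional using (Unique)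
open import Data.Nat using (ℕ; suc; _+_; _*_; _∸_; _⊔_; _≤_; _<_; _≰_; _≡ᵇ_; s≤s; z<s; s<s; s≤s⁻¹)
open import Data.Nat.Properties
open import Data.Product using (_×_; _,_; proj₁; proj₂; ∃-syntax; ∃₂)
open import Data.Sum using (_⊎_; inj₁; inj₂)
open import Function using (_∘_)
open import Relation.Binary.PropositionalEquality
open import Relation.Binary.Definitions using (tri<; tri≈; tri>)
open import Relation.Nullary using (¬_; Dec; does; yes; no)
open import Relation.Nullary.Decidable using (dec-true; dec-false)

lookup-injective : ∀ {A : Set} {xs : List A} → Unique xs → ∀ i j → lookup xs i ≡ lookup xs j → i ≡ j
lookup-injective {xs = _ ∷ _} _ fzero fzero _ = refl
lookup-injective (x∉ ∷ _) fzero (fsuc j) eq = ⊥-elim (All.lookup x∉ (∈-lookup j) eq)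
lookup-injective (x∉ ∷ _) (fsuc i) fzero eq = ⊥-elim (All.lookup x∉ (∈-lookup i) (sym eq))
lookup-injective (_ ∷ unique) (fsuc i) (fsuc j) eq = cong fsuc (lookup-injective unique i j eq)

length≤-by-injection : ∀ {A : Set} {P : A → Set} {k} (f : ∀ {y} → P y → Fin k) →
                       (∀ {y y'} (py : P y) (py' : P y') → f py ≡ f py' → y ≡ y') →
                       ∀ {ys} → Unique ys → All P ys → length ys ≤ k
length≤-by-injection f f-injective unique all = ≮⇒≥ λ k<len →
  let i , j , i<j , fi≡fj = pigeonhole k<len (λ i → f (All.lookup all (∈-lookup i)))
  in <⇒≢ i<j (cong toℕ (lookup-injective unique i j (f-injective _ _ fi≡fj)))

length≤-by-membership : ∀ {A : Set} {xs ys : List A} →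
                        Unique ys → All (_∈ xs) ys → length ys ≤ length xs
length≤-by-membership = length≤-by-injection index (index-injective (setoid _))

place-value-< : ∀ {a a' c C} → a < a' → c < C → a * C + c < a' * C
place-value-< {a} {a'} {c} {C} a<a' c<C = begin-strict
  a * C + c <⟨ +-monoʳ-< (a * C) c<C ⟩
  a * C + C ≡⟨ +-comm (a * C) C ⟩
  suc a * C ≤⟨ *-monoˡ-≤ C a<a' ⟩
  a' * C    ∎
  where open ≤-Reasoning

lex-< : ∀ {a a' c c' C} → a < a' → c < C → a * C + c < a' * C + c'
lex-< {a' = a'} {c' = c'} {C} a<a' c<C = <-≤-trans (place-value-< a<a' c<C) (m≤m+n (a' * C) c')

lex-injective : ∀ {a a' c c' C} → c < C → c' < C → a * C + c ≡ a' * C + c' → a ≡ a' × c ≡ c'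
lex-injective {a} {a'} c<C c'<C eq with <-cmp a a'
... | tri< a<a' _ _ = ⊥-elim (<⇒≢ (lex-< a<a' c<C) eq)
... | tri> _ _ a>a' = ⊥-elim (<⇒≢ (lex-< a>a' c'<C) (sym eq))
... | tri≈ _ refl _ = refl , +-cancelˡ-≡ (a * _) _ _ eq

1+k<r⇒r∸1≰k : ∀ {k r} → suc k < r → r ∸ 1 ≰ k
1+k<r⇒r∸1≰k {k} 1+k<r r∸1≤k = n≮n k (<-≤-trans (∸-monoˡ-≤ 1 1+k<r) r∸1≤k)

invariant-at-last-edge :
  ∀ {A : Set} {E : A → A → Set} {Internal : A → Set} {r} (Inv : ℕ → A → Set) →
  (∀ {k z z'} → suc k < r → Inv k z → E z z' → Internal z' → Inv (suc k) z') →
  ∀ {k x y} ps → Inv k x → Linked E (x ∷ ps ++ y ∷ []) → All Internal ps → k + length ps < r →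
  ∃₂ λ k' z → Inv k' z × E z y
invariant-at-last-edge Inv step [] inv (e ∷ [-]) [] _ = _ , _ , inv , e
invariant-at-last-edge {r = r} Inv step {k} (p ∷ ps) inv (e ∷ path) (internal ∷ internals) bound =
  invariant-at-last-edge Inv step ps
    (step (≤-<-trans (m≤m+n (suc k) (length ps)) bound') inv e internal) path internals bound'
  where
  bound' : suc k + length ps < r
  bound' = subst (_< r) (+-suc k (length ps)) bound

module Edges (r : ℕ) (φ : Instance) where

  V : Set
  V = GV r φ

  clauseW : ℕ → List V
  clauseW c = w 0F ∷ w 1F ∷ w 2F ∷ w 3F ∷ (if c ≡ᵇ 2 then w 4F ∷ [] else [])

  literalW : Bool → List V
  literalW true  = w 1F ∷ w 2F ∷ w 3F ∷ []
  literalW false = w 4F ∷ w 5F ∷ w 6F ∷ []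

  data Edge : V → V → Set where
    clique-clique    : ∀ {k k'} → Edge (w k) (w k')
    clause-clique    : ∀ {i k} → w k ∈ clauseW (length (clause φ i)) → Edge (u i) (w k)
    clique-clause    : ∀ {i k} → w k ∈ clauseW (length (clause φ i)) → Edge (w k) (u i)
    literal-negation : ∀ {j b} → Edge (lit j b) (lit j (not b))
    literal-clique   : ∀ {j b k} → w k ∈ literalW b → Edge (lit j b) (w k)
    clique-literal   : ∀ {j b k} → w k ∈ literalW b → Edge (w k) (lit j b)
    clause-sub       : ∀ {i p t} → toℕ t ≡ 0 → Edge (u i) (sub i p t)
    sub-clause       : ∀ {i p t} → toℕ t ≡ 0 → Edge (sub i p t) (u i)
    sub-next         : ∀ {i p t t'} → suc (toℕ t) ≡ toℕ t' → Edge (sub i p t) (sub i p t')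
    sub-prev         : ∀ {i p t t'} → suc (toℕ t') ≡ toℕ t → Edge (sub i p t) (sub i p t')
    sub-literal      : ∀ {i p t j b} → suc (toℕ t) ≡ r ∸ 1 → lookup (clause φ i) p ≡ (j , b) →
                       Edge (sub i p t) (lit j b)
    literal-sub      : ∀ {i p t j b} → suc (toℕ t) ≡ r ∸ 1 → lookup (clause φ i) p ≡ (j , b) →
                       Edge (lit j b) (sub i p t)

  <4⇒∈clauseW : ∀ c (k : Fin 7) → toℕ k < 4 → w k ∈ clauseW c
  <4⇒∈clauseW _ 0F _ = here refl
  <4⇒∈clauseW _ 1F _ = there (here refl)
  <4⇒∈clauseW _ 2F _ = there (there (here refl))
  <4⇒∈clauseW _ 3F _ = there (there (there (here refl)))
  <4⇒∈clauseW _ 4F (s<s (s<s (s<s (s<s ()))))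
  <4⇒∈clauseW _ 5F (s<s (s<s (s<s (s<s ()))))
  <4⇒∈clauseW _ 6F (s<s (s<s (s<s (s<s ()))))

  w4∈clauseW : ∀ {c} → c ≡ 2 → w 4F ∈ clauseW c
  w4∈clauseW refl = there (there (there (there (here refl))))

  clauseW-length : ∀ {c} → c ≡ 2 ⊎ c ≡ 3 → length (clauseW c) + c ≡ 7
  clauseW-length (inj₁ refl) = refl
  clauseW-length (inj₂ refl) = refl

  ∈literalW-true : ∀ (k : Fin 7) → 1 ≤ toℕ k → toℕ k ≤ 3 → w k ∈ literalW true
  ∈literalW-true 0F () _
  ∈literalW-true 1F _ _ = here refl
  ∈literalW-true 2F _ _ = there (here refl)
  ∈literalW-true 3F _ _ = there (there (here refl))
  ∈literalW-true 4F _ (s≤s (s≤s (s≤s ())))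
  ∈literalW-true 5F _ (s≤s (s≤s (s≤s ())))
  ∈literalW-true 6F _ (s≤s (s≤s (s≤s ())))

  ∈literalW-false : ∀ (k : Fin 7) → 4 ≤ toℕ k → w k ∈ literalW false
  ∈literalW-false 0F ()
  ∈literalW-false 1F (s≤s ())
  ∈literalW-false 2F (s≤s (s≤s ()))
  ∈literalW-false 3F (s≤s (s≤s (s≤s ())))
  ∈literalW-false 4F _ = here refl
  ∈literalW-false 5F _ = there (here refl)
  ∈literalW-false 6F _ = there (there (here refl))

  literalW-length : ∀ b → length (literalW b) ≡ 3
  literalW-length true  = refl
  literalW-length false = refl

  ∈literalW⇒∈both : ∀ {b y} → y ∈ literalW b → y ∈ literalW true ++ literalW false
  ∈literalW⇒∈both {true}  = ∈-++⁺ˡ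
  ∈literalW⇒∈both {false} = ∈-++⁺ʳ (literalW true)

  GE⇒Edge : ∀ {a b} → GE r φ a b → Edge a b
  GE⇒Edge (w-w _)               = clique-clique
  GE⇒Edge lit-lit               = literal-negation
  GE⇒Edge (u-w {i} {k} k<4)     = clause-clique (<4⇒∈clauseW (length (clause φ i)) k k<4)
  GE⇒Edge (u-w5 two)            = clause-clique (w4∈clauseW two)
  GE⇒Edge (pos-w {k = k} 1≤k k≤3) = literal-clique (∈literalW-true k 1≤k k≤3)
  GE⇒Edge (neg-w {k = k} 4≤k)   = literal-clique (∈literalW-false k 4≤k)
  GE⇒Edge (u-sub t≡0)           = clause-sub t≡0
  GE⇒Edge (sub-sub next)        = sub-next next
  GE⇒Edge (sub-lit {i} {p} last) with lookup (clause φ i) p in on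
  ... | _ , _ = sub-literal last on

  GE⇒Edge-reversed : ∀ {a b} → GE r φ a b → Edge b a
  GE⇒Edge-reversed (w-w _)               = clique-clique
  GE⇒Edge-reversed lit-lit               = literal-negation
  GE⇒Edge-reversed (u-w {i} {k} k<4)     = clique-clause (<4⇒∈clauseW (length (clause φ i)) k k<4)
  GE⇒Edge-reversed (u-w5 two)            = clique-clause (w4∈clauseW two)
  GE⇒Edge-reversed (pos-w {k = k} 1≤k k≤3) = clique-literal (∈literalW-true k 1≤k k≤3)
  GE⇒Edge-reversed (neg-w {k = k} 4≤k)   = clique-literal (∈literalW-false k 4≤k)
  GE⇒Edge-reversed (u-sub t≡0)           = sub-clause t≡0
  GE⇒Edge-reversed (sub-sub next)        = sub-prev next
  GE⇒Edge-reversed (sub-lit {i} {p} last) with lookup (clause φ i) p in on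
  ... | _ , _ = literal-sub last on

  adjacent⇒Edge : ∀ {a b} → Graph.Adj (G r φ) a b → Edge a b
  adjacent⇒Edge (inj₁ e) = GE⇒Edge e
  adjacent⇒Edge (inj₂ e) = GE⇒Edge-reversed e

module Ordering (r : ℕ) (φ : Instance) (α : Fin (n φ) → Bool) where
  open Edges r φ

  literalLevel : Bool → ℕ
  literalLevel true  = 1
  literalLevel false = 3

  level : V → ℕ
  level (sub _ _ _) = 0
  level (lit j b)   = literalLevel (does (α j ≟ᵇ b))
  level (u _)       = 2
  level (w _)       = 4

  code : V → ℕ
  code (u i)       = toℕ i
  code (lit j _)   = toℕ j
  code (w k)       = toℕ k
  code (sub i p t) = (toℕ i * 3 + toℕ p) * r + toℕ t

  codeBound : ℕ
  codeBound = m φ ⊔ n φ ⊔ 7 ⊔ m φ * 3 * r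

  rank : V → ℕ
  rank x = level x * codeBound + code x

  position<3 : ∀ i (p : Fin (length (clause φ i))) → toℕ p < 3
  position<3 i p with size23 φ i
  ... | inj₁ two   = <-≤-trans (toℕ<n p) (≤-trans (≤-reflexive two) (n≤1+n 2))
  ... | inj₂ three = <-≤-trans (toℕ<n p) (≤-reflexive three)

  offset<r : (t : Fin (r ∸ 1)) → toℕ t < r
  offset<r t = <-≤-trans (toℕ<n t) (m∸n≤m r 1)

  code<codeBound : ∀ x → code x < codeBound
  code<codeBound (u i)       = m<n⇒m<n⊔o _ (m<n⇒m<n⊔o 7 (m<n⇒m<n⊔o (n φ) (toℕ<n i)))
  code<codeBound (lit j _)   = m<n⇒m<n⊔o _ (m<n⇒m<n⊔o 7 (m<n⇒m<o⊔n (m φ) (toℕ<n j)))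
  code<codeBound (w k)       = m<n⇒m<n⊔o _ (m<n⇒m<o⊔n (m φ ⊔ n φ) (toℕ<n k))
  code<codeBound (sub i p t) =
    m<n⇒m<o⊔n _ (place-value-< (place-value-< (toℕ<n i) (position<3 i p)) (offset<r t))

  literalLevel≢ : ∀ s {c} → c ≢ 1 → c ≢ 3 → literalLevel s ≢ c
  literalLevel≢ true  c≢1 _   eq = c≢1 (sym eq)
  literalLevel≢ false _   c≢3 eq = c≢3 (sym eq)

  literalLevel-injective : ∀ a {b b'} →
                           literalLevel (does (a ≟ᵇ b)) ≡ literalLevel (does (a ≟ᵇ b')) → b ≡ b'
  literalLevel-injective true  {true}  {true}  _ = refl
  literalLevel-injective true  {true}  {false} ()
  literalLevel-injective true  {false} {true}  ()
  literalLevel-injective true  {false} {false} _ = refl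
  literalLevel-injective false {true}  {true}  _ = refl
  literalLevel-injective false {true}  {false} ()
  literalLevel-injective false {false} {true}  ()
  literalLevel-injective false {false} {false} _ = refl

  level-code-injective : ∀ a b → level a ≡ level b → code a ≡ code b → a ≡ b
  level-code-injective (u i)       (u i')         _ eq = cong u (toℕ-injective eq)
  level-code-injective (u _)       (lit _ _)      l _  = ⊥-elim (literalLevel≢ _ (λ ()) (λ ()) (sym l))
  level-code-injective (u _)       (w _)          () _
  level-code-injective (u _)       (sub _ _ _)    () _
  level-code-injective (lit _ _)   (u _)          l _  = ⊥-elim (literalLevel≢ _ (λ ()) (λ ()) l)
  level-code-injective (lit j b)   (lit j' b')    l eq with toℕ-injective {i = j} {j = j'} eq
  ... | refl = cong (lit j) (literalLevel-injective (α j) l)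
  level-code-injective (lit _ _)   (w _)          l _  = ⊥-elim (literalLevel≢ _ (λ ()) (λ ()) l)
  level-code-injective (lit _ _)   (sub _ _ _)    l _  = ⊥-elim (literalLevel≢ _ (λ ()) (λ ()) l)
  level-code-injective (w _)       (u _)          () _
  level-code-injective (w _)       (lit _ _)      l _  = ⊥-elim (literalLevel≢ _ (λ ()) (λ ()) (sym l))
  level-code-injective (w k)       (w k')         _ eq = cong w (toℕ-injective eq)
  level-code-injective (w _)       (sub _ _ _)    () _
  level-code-injective (sub _ _ _) (u _)          () _
  level-code-injective (sub _ _ _) (lit _ _)      l _  = ⊥-elim (literalLevel≢ _ (λ ()) (λ ()) (sym l))
  level-code-injective (sub _ _ _) (w _)          () _
  level-code-injective (sub i p t) (sub i' p' t') _ eq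
    with ip≡ , t≡ ← lex-injective (offset<r t) (offset<r t') eq
    with i≡ , p≡ ← lex-injective (position<3 i p) (position<3 i' p') ip≡
    with refl ← toℕ-injective {i = i} {j = i'} i≡
    with refl ← toℕ-injective {i = p} {j = p'} p≡
    with refl ← toℕ-injective {i = t} {j = t'} t≡
    = refl

  rank-injective : ∀ {a b} → rank a ≡ rank b → a ≡ b
  rank-injective {a} {b} eq =
    let level≡ , code≡ = lex-injective (code<codeBound a) (code<codeBound b) eq
    in level-code-injective a b level≡ code≡

  -- A record rather than a synonym for rank y < rank x, so that y and x can be inferred from a proof.
  record _≺_ (y x : V) : Set where
    constructor rank<⇒≺
    field ≺⇒rank< : rank y < rank x
  open _≺_

  ≺-irrefl : ∀ {x} → ¬ x ≺ x
  ≺-irrefl (rank<⇒≺ lt) = n≮n _ lt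

  ≺-asym : ∀ {x y} → x ≺ y → ¬ y ≺ x
  ≺-asym (rank<⇒≺ lt) (rank<⇒≺ gt) = <-asym lt gt

  level-<⇒≺ : ∀ {y x} → level y < level x → y ≺ x
  level-<⇒≺ {y} lt = rank<⇒≺ (lex-< lt (code<codeBound y))

  sub-≺⇒< : ∀ {i p t t'} → sub i p t' ≺ sub i p t → toℕ t' < toℕ t
  sub-≺⇒< (rank<⇒≺ lt) = +-cancelˡ-< _ _ _ lt

  <⇒sub-≺ : ∀ {i p t t'} → toℕ t' < toℕ t → sub i p t' ≺ sub i p t
  <⇒sub-≺ lt = rank<⇒≺ (+-monoʳ-< _ lt)

  level-satisfied : ∀ {j b} → α j ≡ b → level (lit j b) ≡ 1
  level-satisfied {j} {b} αj≡b = cong literalLevel (dec-true (α j ≟ᵇ b) αj≡b)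

  level-falsified : ∀ {j b} → α j ≢ b → level (lit j b) ≡ 3
  level-falsified {j} {b} αj≢b = cong literalLevel (dec-false (α j ≟ᵇ b) αj≢b)

  0<literalLevel<4 : ∀ s → 0 < literalLevel s × literalLevel s < 4
  0<literalLevel<4 true  = z<s , s<s z<s
  0<literalLevel<4 false = z<s , s<s (s<s (s<s z<s))

  module RelativeTo (x : V) {L : ℕ} (level-x : level x ≡ L) where

    ⊀-above : ∀ {z} → L < level z → ¬ z ≺ x
    ⊀-above {z} lt internal = ≺-asym internal (level-<⇒≺ (subst (_< level z) (sym level-x) lt))

    ≺-below : ∀ {y} → level y < L → y ≺ x
    ≺-below {y} lt = level-<⇒≺ (subst (level y <_) (sym level-x) lt)

  Reach : V → V → Set
  Reach = Reachable (G r φ) r rank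

  ≺⇒≢reachable : ∀ {x y z} → z ≺ x → Reach x y → z ≢ y
  ≺⇒≢reachable (rank<⇒≺ z<x) (_ , y≮x , _) refl = y≮x z<x

  reach-by-invariant : ∀ {x} (Inv : ℕ → V → Set) {Candidate : V → Set} → Inv 0 x →
    (∀ {k z z'} → suc k < r → Inv k z → Edge z z' → z' ≺ x → Inv (suc k) z') →
    (∀ {k z y} → Inv k z → Edge z y → y ≢ x → ¬ y ≺ x → Candidate y) →
    ∀ {y} → Reach x y → Candidate y
  reach-by-invariant Inv start step final (y≢x , y⊀x , ps , path , _ , short , internal) =
    let _ , _ , inv , e = invariant-at-last-edge Inv step ps start
                            (Linked.map adjacent⇒Edge path) (All.map rank<⇒≺ internal) short
    in final inv e y≢x (y⊀x ∘ ≺⇒rank<)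

  reach-from-clique : ∀ {k y} → Reach (w k) y → y ∈ map w (allFin 7)
  reach-from-clique {k} {y} (_ , y⊀x , _) = candidate y (y⊀x ∘ ≺⇒rank<)
    where
    open RelativeTo (w k) refl
    candidate : ∀ y → ¬ y ≺ w k → y ∈ map w (allFin 7)
    candidate (w k')        _   = ∈-map⁺ w (∈-allFin k')
    candidate (u _)         y⊀x = ⊥-elim (y⊀x (≺-below (s<s (s<s z<s))))
    candidate (lit _ _)     y⊀x = ⊥-elim (y⊀x (≺-below (proj₂ (0<literalLevel<4 _))))
    candidate (sub _ _ _)   y⊀x = ⊥-elim (y⊀x (≺-below z<s))

  module FromSub (i : Fin (m φ)) (p : Fin (length (clause φ i))) (t : Fin (r ∸ 1)) where
    open RelativeTo (sub i p t) refl

    data Candidate : V → Set where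
      clause-end  : Candidate (u i)
      literal-end : ∀ {j b} → lookup (clause φ i) p ≡ (j , b) → Candidate (lit j b)
      successor   : ∀ {t'} → toℕ t' ≡ suc (toℕ t) → Candidate (sub i p t')

    slot : ∀ {y} → Candidate y → Fin 3
    slot clause-end      = 0F
    slot (literal-end _) = 1F
    slot (successor _)   = 2F

    slot-injective : ∀ {y y'} (c : Candidate y) (c' : Candidate y') → slot c ≡ slot c' → y ≡ y'
    slot-injective clause-end       clause-end        _ = refl
    slot-injective (literal-end on) (literal-end on') _ with refl ← trans (sym on) on' = refl
    slot-injective (successor e)    (successor e')    _ =
      cong (sub i p) (toℕ-injective (trans e (sym e')))
    slot-injective clause-end       (literal-end _)   ()
    slot-injective clause-end       (successor _)     ()
    slot-injective (literal-end _)  clause-end        ()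
    slot-injective (literal-end _)  (successor _)     ()
    slot-injective (successor _)    clause-end        ()
    slot-injective (successor _)    (literal-end _)   ()

    OnPath : V → Set
    OnPath z = ∃[ t' ] z ≡ sub i p t' × toℕ t' ≤ toℕ t

    step : ∀ {k z z'} → suc k < r → OnPath z → Edge z z' → z' ≺ sub i p t → OnPath z'
    step _ (_ , refl , _) (sub-clause _)    internal = ⊥-elim (⊀-above z<s internal)
    step _ (_ , refl , _) (sub-next _)      internal = _ , refl , <⇒≤ (sub-≺⇒< internal)
    step _ (_ , refl , _) (sub-prev _)      internal = _ , refl , <⇒≤ (sub-≺⇒< internal)
    step _ (_ , refl , _) (sub-literal _ _) internal =
      ⊥-elim (⊀-above (proj₁ (0<literalLevel<4 _)) internal)

    final : ∀ {z y} → OnPath z → Edge z y → y ≢ sub i p t → ¬ y ≺ sub i p t → Candidate y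
    final (_ , refl , _)    (sub-clause _)     _   _   = clause-end
    final (_ , refl , t'≤t) (sub-next e)       y≢x y⊀x = successor (≤-antisym
      (subst (_≤ suc (toℕ t)) e (s≤s t'≤t))
      (≤∧≢⇒< (≮⇒≥ (y⊀x ∘ <⇒sub-≺)) (λ t≡t'' → y≢x (cong (sub i p) (toℕ-injective (sym t≡t''))))))
    final (_ , refl , t'≤t) (sub-prev e)       _   y⊀x =
      ⊥-elim (y⊀x (<⇒sub-≺ (<-≤-trans (≤-reflexive e) t'≤t)))
    final (_ , refl , _)    (sub-literal _ on) _   _   = literal-end on

    reach-from-sub : ∀ {y} → Reach (sub i p t) y → Candidate y
    reach-from-sub = reach-by-invariant (λ _ → OnPath) (t , refl , ≤-refl) step final

  module FromSatisfied (j : Fin (n φ)) (b : Bool) (satisfied : α j ≡ b) (i₁ i₂ : Fin (m φ))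
                       (occurrences : ∀ i → (j , b) ∈ clause φ i → i ≡ i₁ ⊎ i ≡ i₂) where
    open RelativeTo (lit j b) (level-satisfied satisfied)

    candidates : List V
    candidates = lit j (not b) ∷ u i₁ ∷ u i₂ ∷ literalW b

    NearLiteral : V → Set
    NearLiteral z = z ≡ lit j b
                  ⊎ ∃[ i ] ∃[ p ] ∃[ t ] z ≡ sub i p t × lookup (clause φ i) p ≡ (j , b)

    step : ∀ {k z z'} → suc k < r → NearLiteral z → Edge z z' → z' ≺ lit j b → NearLiteral z'
    step _ (inj₁ refl) literal-negation internal =
      ⊥-elim (⊀-above (subst (1 <_) (sym (level-falsified (not-¬ satisfied))) (s<s z<s)) internal)
    step _ (inj₁ refl) (literal-clique _) internal = ⊥-elim (⊀-above (s<s z<s) internal)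
    step _ (inj₁ refl) (literal-sub _ on) _ = inj₂ (_ , _ , _ , refl , on)
    step _ (inj₂ (_ , _ , _ , refl , _))  (sub-clause _) internal = ⊥-elim (⊀-above (s<s z<s) internal)
    step _ (inj₂ (i , p , _ , refl , on)) (sub-next _)   _        = inj₂ (i , p , _ , refl , on)
    step _ (inj₂ (i , p , _ , refl , on)) (sub-prev _)   _        = inj₂ (i , p , _ , refl , on)
    step _ (inj₂ (_ , _ , _ , refl , on)) (sub-literal _ on') internal
      with refl ← trans (sym on') on = ⊥-elim (≺-irrefl internal)

    final : ∀ {z y} → NearLiteral z → Edge z y → y ≢ lit j b → ¬ y ≺ lit j b → y ∈ candidates
    final (inj₁ refl) literal-negation    _ _   = here refl
    final (inj₁ refl) (literal-clique w∈) _ _   = there (there (there w∈))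
    final (inj₁ refl) (literal-sub _ _)   _ y⊀x = ⊥-elim (y⊀x (≺-below z<s))
    final (inj₂ (i , p , _ , refl , on)) (sub-clause _) _ _
      with occurrences i (subst (_∈ clause φ i) on (∈-lookup p))
    ... | inj₁ refl = there (here refl)
    ... | inj₂ refl = there (there (here refl))
    final (inj₂ (_ , _ , _ , refl , _))  (sub-next _) _ y⊀x = ⊥-elim (y⊀x (≺-below z<s))
    final (inj₂ (_ , _ , _ , refl , _))  (sub-prev _) _ y⊀x = ⊥-elim (y⊀x (≺-below z<s))
    final (inj₂ (_ , _ , _ , refl , on)) (sub-literal _ on') y≢x _
      with refl ← trans (sym on') on = ⊥-elim (y≢x refl)

    reach-from-satisfied : ∀ {y} → Reach (lit j b) y → y ∈ candidates
    reach-from-satisfied = reach-by-invariant (λ _ → NearLiteral) (inj₁ refl) step final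

  module FromFalsified (j : Fin (n φ)) (b : Bool) (falsified : α j ≢ b) where
    open RelativeTo (lit j b) (level-falsified falsified)

    -- Position t of a subdivided edge is r ∸ 1 ∸ t steps away from its literal end, so a walk of
    -- k steps from x only reaches positions with r ∸ 1 ≤ t + k: the clause end, r steps away, can
    -- only be the last vertex of the walk, and it lies below x.
    NearVariable : ℕ → V → Set
    NearVariable k z =
      (∃[ b' ] z ≡ lit j b')
      ⊎ (∃[ i ] ∃[ p ] ∃[ t ] z ≡ sub i p t × proj₁ (lookup (clause φ i) p) ≡ j × r ∸ 1 ≤ toℕ t + k)

    twin≺ : ∀ {b'} → b' ≢ b → lit j b' ≺ lit j b
    twin≺ {b'} b'≢b = ≺-below (subst (_< 3) (sym (level-satisfied αj≡b')) (s<s z<s))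
      where
      αj≡b' : α j ≡ b'
      αj≡b' = trans (¬-not falsified) (sym (¬-not b'≢b))

    step : ∀ {k z z'} → suc k < r → NearVariable k z → Edge z z' → z' ≺ lit j b → NearVariable (suc k) z'
    step _ (inj₁ (_ , refl)) literal-negation   _        = inj₁ (_ , refl)
    step _ (inj₁ (_ , refl)) (literal-clique _) internal = ⊥-elim (⊀-above (s<s (s<s (s<s z<s))) internal)
    step {k} _ (inj₁ (_ , refl)) (literal-sub {t = t} last on) _ =
      inj₂ (_ , _ , _ , refl , cong proj₁ on , subst (_≤ toℕ t + suc k) last (m<m+n (toℕ t) z<s))
    step {k} 1+k<r (inj₂ (_ , _ , _ , refl , _ , far)) (sub-clause t≡0) _ =
      ⊥-elim (1+k<r⇒r∸1≰k 1+k<r (subst (λ t → r ∸ 1 ≤ t + k) t≡0 far))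
    step {k} _ (inj₂ (i , p , t , refl , var , far)) (sub-next next) _ =
      inj₂ (i , p , _ , refl , var ,
            ≤-trans far (+-mono-≤ (subst (toℕ t ≤_) next (n≤1+n _)) (n≤1+n k)))
    step {k} _ (inj₂ (i , p , t , refl , var , far)) (sub-prev {t' = t'} prev) _ =
      inj₂ (i , p , _ , refl , var ,
            subst (r ∸ 1 ≤_) (trans (cong (_+ k) (sym prev)) (sym (+-suc (toℕ t') k))) far)
    step _ (inj₂ (_ , _ , _ , refl , var , _)) (sub-literal _ on) _
      with refl ← trans (sym (cong proj₁ on)) var = inj₁ (_ , refl)

    final : ∀ {k z y} → NearVariable k z → Edge z y → y ≢ lit j b → ¬ y ≺ lit j b →
            y ∈ literalW true ++ literalW false
    final (inj₁ (_ , refl)) literal-negation    y≢x y⊀x = ⊥-elim (y⊀x (twin≺ (y≢x ∘ cong (lit j))))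
    final (inj₁ (_ , refl)) (literal-clique w∈) _   _   = ∈literalW⇒∈both w∈
    final (inj₁ (_ , refl)) (literal-sub _ _)   _   y⊀x = ⊥-elim (y⊀x (≺-below z<s))
    final (inj₂ (_ , _ , _ , refl , _ , _)) (sub-clause _) _ y⊀x =
      ⊥-elim (y⊀x (≺-below (s<s (s<s z<s))))
    final (inj₂ (_ , _ , _ , refl , _ , _)) (sub-next _) _ y⊀x = ⊥-elim (y⊀x (≺-below z<s))
    final (inj₂ (_ , _ , _ , refl , _ , _)) (sub-prev _) _ y⊀x = ⊥-elim (y⊀x (≺-below z<s))
    final (inj₂ (_ , _ , _ , refl , var , _)) (sub-literal _ on) y≢x y⊀x
      with refl ← trans (sym (cong proj₁ on)) var = ⊥-elim (y⊀x (twin≺ (y≢x ∘ cong (lit j))))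

    reach-from-falsified : ∀ {y} → Reach (lit j b) y → y ∈ literalW true ++ literalW false
    reach-from-falsified = reach-by-invariant NearVariable (inj₁ (b , refl)) step final

  module FromClause (i : Fin (m φ)) where
    open RelativeTo (u i) refl

    candidates : List V
    candidates = clauseW (length (clause φ i)) ++ map litV (clause φ i)

    -- A walk of k steps from u i stays at positions t < k, so it meets a literal vertex,
    -- r steps away, only as its last vertex.
    NearClause : ℕ → V → Set
    NearClause k z = z ≡ u i ⊎ ∃[ p ] ∃[ t ] z ≡ sub i p t × toℕ t < k

    step : ∀ {k z z'} → suc k < r → NearClause k z → Edge z z' → z' ≺ u i → NearClause (suc k) z'
    step _ (inj₁ refl) (clause-clique _) internal = ⊥-elim (⊀-above (s<s (s<s z<s)) internal)
    step {k} _ (inj₁ refl) (clause-sub t≡0) _ = inj₂ (_ , _ , refl , subst (_< suc k) (sym t≡0) z<s)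
    step _ (inj₂ (_ , _ , refl , _)) (sub-clause _) internal = ⊥-elim (≺-irrefl internal)
    step _ (inj₂ (p , _ , refl , t<k)) (sub-next next) _ =
      inj₂ (p , _ , refl , subst (_< suc _) next (s<s t<k))
    step _ (inj₂ (p , _ , refl , t<k)) (sub-prev prev) _ =
      inj₂ (p , _ , refl , m<n⇒m<1+n (<-trans (subst (_ <_) prev (n<1+n _)) t<k))
    step {k} 1+k<r (inj₂ (_ , _ , refl , t<k)) (sub-literal last _) _ =
      ⊥-elim (1+k<r⇒r∸1≰k 1+k<r (subst (_≤ k) last t<k))

    final : ∀ {k z y} → NearClause k z → Edge z y → y ≢ u i → ¬ y ≺ u i → y ∈ candidates
    final (inj₁ refl) (clause-clique w∈) _ _   = ∈-++⁺ˡ w∈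
    final (inj₁ refl) (clause-sub _)     _ y⊀x = ⊥-elim (y⊀x (≺-below z<s))
    final (inj₂ (_ , _ , refl , _)) (sub-clause _) y≢x _ = ⊥-elim (y≢x refl)
    final (inj₂ (_ , _ , refl , _)) (sub-next _)   _ y⊀x = ⊥-elim (y⊀x (≺-below z<s))
    final (inj₂ (_ , _ , refl , _)) (sub-prev _)   _ y⊀x = ⊥-elim (y⊀x (≺-below z<s))
    final (inj₂ (p , _ , refl , _)) (sub-literal _ on) _ _ =
      ∈-++⁺ʳ _ (∈-map⁺ litV (subst (_∈ clause φ i) on (∈-lookup p)))

    satisfied≺clause : ∀ ℓ → α (proj₁ ℓ) ≡ proj₂ ℓ → litV ℓ ≺ u i
    satisfied≺clause _ satisfied = ≺-below (subst (_< 2) (sym (level-satisfied satisfied)) (s<s z<s))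

    reach-from-clause : ∀ {y} → Reach (u i) y → y ∈ candidates
    reach-from-clause = reach-by-invariant NearClause (inj₁ refl) step final

    candidates-length : length candidates ≡ 7
    candidates-length = begin
      length (clauseW c ++ map litV (clause φ i))         ≡⟨ length-++ (clauseW c) ⟩
      length (clauseW c) + length (map litV (clause φ i)) ≡⟨ cong (length (clauseW c) +_) length-literals ⟩
      length (clauseW c) + c                              ≡⟨ clauseW-length (size23 φ i) ⟩
      7                                                   ∎
      where
      c : ℕ
      c = length (clause φ i)
      length-literals : length (map litV (clause φ i)) ≡ c
      length-literals = length-map litV (clause φ i)
      open ≡-Reasoning

  reachable-≤6 : (∀ i → ∃[ ℓ ] ℓ ∈ clause φ i × α (proj₁ ℓ) ≡ proj₂ ℓ) →
                 ∀ x (ys : List V) → Unique ys → All (Reach x) ys → length ys ≤ 6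
  reachable-≤6 _ (w k) _ unique reach = s≤s⁻¹ (length≤-by-membership
    (All.map (≢-sym ∘ proj₁) reach ∷ unique)
    (∈-map⁺ w (∈-allFin k) ∷ All.map reach-from-clique reach))
  reachable-≤6 _ (sub i p t) _ unique reach =
    ≤-trans (length≤-by-injection slot slot-injective unique (All.map reach-from-sub reach)) (m≤m+n 3 3)
    where open FromSub i p t
  reachable-≤6 satisfiable (u i) ys unique reach =
    let ℓ , ℓ∈ , satisfied = satisfiable i
    in s≤s⁻¹ (subst (suc (length ys) ≤_) candidates-length (length≤-by-membership
         (All.map (≺⇒≢reachable (satisfied≺clause ℓ satisfied)) reach ∷ unique)
         (∈-++⁺ʳ _ (∈-map⁺ litV ℓ∈) ∷ All.map reach-from-clause reach)))
    where open FromClause i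
  reachable-≤6 _ (lit j b) ys unique reach = by-value (α j ≟ᵇ b)
    where
    by-value : Dec (α j ≡ b) → length ys ≤ 6
    by-value (yes satisfied) =
      let i₁ , i₂ , _ , _ , _ , occurrences = exactlyTwo φ (j , b)
          open FromSatisfied j b satisfied i₁ i₂ occurrences
      in subst (length ys ≤_) (cong (3 +_) (literalW-length b))
           (length≤-by-membership unique (All.map reach-from-satisfied reach))
    by-value (no falsified) =
      length≤-by-membership unique (All.map (FromFalsified.reach-from-falsified j b falsified) reach)

lemma5 : (r : ℕ) → 2 ≤ r → (φ : Instance) → Satisfiable φ → ColLe (G r φ) r 6
lemma5 r _ φ (α , satisfiable) = rank , rank-injective , reachable-≤6 satisfiable
  where open Ordering r φ α
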